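{- Let $\mathcal{K}$ be a coronoid. A subset $\widetilde{\mathcal{K}}\subseteq\mathcal{H}$ satisfies the three conditions (i) $\widetilde{\mathcal{K}}$ is a benzenoid, (ii) $\mathcal{K}\subseteq\widetilde{\mathcal{K}}$, and (iii) for every benzenoid $\mathcal{L}$ with $\mathcal{K}\subseteq\mathcal{L}$ one has $\widetilde{\mathcal{K}}\subseteq\mathcal{L}$, if and only if $\widetilde{\mathcal{K}}=\overline{\mathcal{K}}$. In particular the alternative benzenoid closure defined by (i)–(iii) exists, is unique, and coincides with the benzenoid closure.
   Context: $\mathcal{H}$ is the set of hexagons of the regular hexagonal tiling of the plane; hexagons are adjacent if distinct and sharing an edge; a set of hexagons is connected if non-empty and any two of its hexagons are joined by a sequence of its hexagons with consecutive ones adjacent. A coronoid is a finite connected subset of $\mathcal{H}$; a benzenoid is a coronoid whose complement in $\mathcal{H}$ is connected. The benzenoid closure is $\overline{\mathcal{K}}=\bigcap\{\mathcal{B}:\mathcal{B}\text{ a benzenoid},\ \mathcal{K}\subseteq\mathcal{B}\}$. -}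

module Defs where

open import Data.Bool using (Bool; true; false)
open import Data.Integer using (ℤ; +_; -[1+_]; _+_)
open import Data.Product using (_×_; _,_; ∃; ∃-syntax; Σ)
open import Data.Sum using (_⊎_)
open import Data.List using (List)
open import Data.List.Membership.Propositional using () renaming (_∈_ to _∈ₗ_)
open import Relation.Binary.PropositionalEquality using (_≡_)

-- Hexagons of the regular hexagonal tiling, in axial coordinates (q , r).
Hex : Set
Hex = ℤ × ℤ

data Dir : ℤ × ℤ → Set where
  d1 : Dir (+ 1 , + 0)
  d2 : Dir (-[1+ 0 ] , + 0)
  d3 : Dir (+ 0 , + 1)
  d4 : Dir (+ 0 , -[1+ 0 ])
  d5 : Dir (+ 1 , -[1+ 0 ])
  d6 : Dir (-[1+ 0 ] , + 1)

-- Two hexagons are adjacent iff they are distinct and share an edge,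
-- i.e. b = a + d for one of the six unit directions d (this forces a ≠ b).
Adjacent : Hex → Hex → Set
Adjacent (a₁ , a₂) (b₁ , b₂) =
  Σ (ℤ × ℤ) λ d → Dir d × (b₁ ≡ a₁ + Data.Product.proj₁ d) × (b₂ ≡ a₂ + Data.Product.proj₂ d)

HexSet : Set
HexSet = Hex → Bool

_∈_ : Hex → HexSet → Set
h ∈ S = S h ≡ true

_⊆_ : HexSet → HexSet → Set
S ⊆ T = ∀ h → h ∈ S → h ∈ T

compl : HexSet → HexSet
compl S h = Data.Bool.not (S h)

data Walk (P : Hex → Set) : Hex → Hex → Set where
  stop : ∀ {a} → P a → Walk P a a
  step : ∀ {a b c} → P a → Adjacent a b → Walk P b c → Walk P a c

Connected : HexSet → Set
Connected S = (∃[ h ] h ∈ S) × (∀ a b → a ∈ S → b ∈ S → Walk (λ h → h ∈ S) a b)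

Finite : HexSet → Set
Finite S = ∃[ xs ] (∀ h → h ∈ S → h ∈ₗ xs)

Coronoid : HexSet → Set
Coronoid S = Finite S × Connected S

Benzenoid : HexSet → Set
Benzenoid S = Coronoid S × Connected (compl S)

closure : HexSet → Hex → Set
closure K h = ∀ (B : HexSet) → Benzenoid B → K ⊆ B → h ∈ B

-- Put K inside the box |q|, |r| ≤ M and call a hexagon escaping if it lies outside the box or
-- can walk outside it through hexagons of the box of radius M + 1 that are not in K. Escaping
-- is decidable (a search in a finite region), and the hull, the set of non-escaping hexagons,
-- is the least benzenoid containing K, hence the closure. The key fact is that a hexagon not
-- in K next to an escaping one escapes. So walking from a hull hexagon along a ray one meets
-- K before leaving the hull, which makes the hull connected; and a hexagon off a benzenoid
-- L ⊇ K escapes along a walk in the complement of L to a point beyond the box. The complement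
-- of the hull is connected since every escaping hexagon walks to one corner just off the box.
module Submission where

open import Defs
import Data.Integer.Properties as ℤP
open import Algebra.Properties.AbelianGroup ℤP.+-0-abelianGroup
  using (\\-leftDividesˡ; //-rightDividesʳ)
open import Data.Bool using (true; false; not) renaming (_≟_ to _≟ᵇ_)
open import Data.Bool.Properties using (not-injective; not-¬; ¬-not)
open import Data.Integer using (ℤ; +_; -[1+_]; _+_; -_; ∣_∣)
open import Data.List using (List; []; _∷_; length; map; _++_; upTo; filter; cartesianProduct)
open import Data.List.Membership.Propositional using (find; lose) renaming (_∈_ to _∈ₗ_)
open import Data.List.Membership.Propositional.Properties
  using (∈-++⁺ˡ; ∈-++⁺ʳ; ∈-map⁺; ∈-upTo⁺; ∈-filter⁺; ∈-cartesianProduct⁺)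
open import Data.List.Properties using (filter-notAll)
open import Data.List.Relation.Unary.Any as Any using (Any; here; there)
open import Data.Nat as ℕ using (ℕ; suc; _≤_; _<_; s≤s)
open import Data.Nat.Induction using (<-wellFounded)
import Data.Nat.Properties as ℕP
open import Data.Product using (_×_; _,_; ∃-syntax; proj₁; proj₂)
open import Data.Product.Properties using (≡-dec)
open import Data.Sum using (_⊎_; inj₁; inj₂; [_,_])
open import Data.Unit using (⊤; tt)
open import Data.Empty using (⊥-elim)
open import Function using (_∘_)
open import Function.Bundles using (_⇔_; mk⇔; Equivalence)
open import Induction.WellFounded using (Acc; acc)
open import Relation.Binary.Definitions using (DecidableEquality)
open import Relation.Binary.PropositionalEquality hiding ([_])
open import Relation.Nullary using (¬_; yes; no; does)
open import Relation.Nullary.Decidable using (_⊎-dec_; _×-dec_; ¬?; map′; decidable-stable; dec-true; dec-false)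
open import Relation.Unary using (Decidable)

∈compl⇒∉ : ∀ {b} → not b ≡ true → ¬ b ≡ true
∈compl⇒∉ ¬b b = not-¬ b (not-injective ¬b)

∉⇒∈compl : ∀ {b} → ¬ b ≡ true → not b ≡ true
∉⇒∈compl b≢true = cong not (¬-not b≢true)

∉compl⇒∈ : ∀ {b} → ¬ not b ≡ true → b ≡ true
∉compl⇒∈ ¬b≢true = ¬-not (¬b≢true ∘ cong not)

compl-anti : ∀ {S S′} → S ⊆ S′ → compl S′ ⊆ compl S
compl-anti S⊆S′ h h∈∁S′ = ∉⇒∈compl (∈compl⇒∉ h∈∁S′ ∘ S⊆S′ h)

mapWalk : ∀ {P Q : Hex → Set} → (∀ {h} → P h → Q h) → ∀ {a b} → Walk P a b → Walk Q a b
mapWalk f (stop p) = stop (f p)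
mapWalk f (step p adj w) = step (f p) adj (mapWalk f w)

walkHead : ∀ {P : Hex → Set} {a b} → Walk P a b → P a
walkHead (stop p) = p
walkHead (step p _ _) = p

infixr 5 _◅◅_
_◅◅_ : ∀ {P : Hex → Set} {a b c} → Walk P a b → Walk P b c → Walk P a c
stop _ ◅◅ w′ = w′
step p adj w ◅◅ w′ = step p adj (w ◅◅ w′)

Adjacent-sym : ∀ {a b} → Adjacent a b → Adjacent b a
Adjacent-sym {q , r} (_ , d1 , refl , refl) = _ , d2 , sym (//-rightDividesʳ _ q) , sym (//-rightDividesʳ _ r)
Adjacent-sym {q , r} (_ , d2 , refl , refl) = _ , d1 , sym (//-rightDividesʳ _ q) , sym (//-rightDividesʳ _ r)
Adjacent-sym {q , r} (_ , d3 , refl , refl) = _ , d4 , sym (//-rightDividesʳ _ q) , sym (//-rightDividesʳ _ r)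
Adjacent-sym {q , r} (_ , d4 , refl , refl) = _ , d3 , sym (//-rightDividesʳ _ q) , sym (//-rightDividesʳ _ r)
Adjacent-sym {q , r} (_ , d5 , refl , refl) = _ , d6 , sym (//-rightDividesʳ _ q) , sym (//-rightDividesʳ _ r)
Adjacent-sym {q , r} (_ , d6 , refl , refl) = _ , d5 , sym (//-rightDividesʳ _ q) , sym (//-rightDividesʳ _ r)

reverse : ∀ {P : Hex → Set} {a b} → Walk P a b → Walk P b a
reverse (stop p) = stop p
reverse (step p adj w) = reverse w ◅◅ step (walkHead w) (Adjacent-sym adj) (stop p)

Finite-anti : ∀ {S S′} → S′ ⊆ S → Finite S → Finite S′
Finite-anti S′⊆S (hs , S⊆hs) = hs , λ h → S⊆hs h ∘ S′⊆S h

Connected-resp : ∀ {S S′} → S ⊆ S′ → S′ ⊆ S → Connected S → Connected S′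
Connected-resp S⊆S′ S′⊆S ((h , h∈S) , walks) =
  (h , S⊆S′ h h∈S) ,
  λ a b a∈S′ b∈S′ → mapWalk (S⊆S′ _) (walks a b (S′⊆S a a∈S′) (S′⊆S b b∈S′))

Benzenoid-resp : ∀ {S S′} → S ⊆ S′ → S′ ⊆ S → Benzenoid S → Benzenoid S′
Benzenoid-resp S⊆S′ S′⊆S ((fin , con) , con∁) =
  (Finite-anti S′⊆S fin , Connected-resp S⊆S′ S′⊆S con) ,
  Connected-resp (compl-anti S′⊆S) (compl-anti S⊆S′) con∁

module _ {P : Hex → Set} (line : ℤ → Hex)
         (line-adj : ∀ t → Adjacent (line t) (line (t + + 1)))
         (line⊆P : ∀ t → P (line t)) where

  walk-forward : ∀ s n → Walk P (line s) (line (s + + n))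
  walk-forward s ℕ.zero = subst (Walk P (line s) ∘ line) (sym (ℤP.+-identityʳ s)) (stop (line⊆P s))
  walk-forward s (suc n) = step (line⊆P s) (line-adj s)
    (subst (Walk P (line (s + + 1)) ∘ line) (ℤP.+-assoc s (+ 1) (+ n)) (walk-forward (s + + 1) n))

  walk-by : ∀ s d → Walk P (line s) (line (s + d))
  walk-by s (+ n) = walk-forward s n
  walk-by s -[1+ n ] = reverse
    (subst (λ u → Walk P (line (s + -[1+ n ])) (line u)) (//-rightDividesʳ -[1+ n ] s)
      (walk-forward (s + -[1+ n ]) (suc n)))

  walk-along : ∀ s t → Walk P (line s) (line t)
  walk-along s t = subst (Walk P (line s) ∘ line) (\\-leftDividesˡ s t) (walk-by s (- s + t))

qAxis-adj : ∀ r t → Adjacent (t , r) (t + + 1 , r)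
qAxis-adj r t = _ , d1 , refl , sym (ℤP.+-identityʳ r)

rAxis-adj : ∀ q t → Adjacent (q , t) (q , t + + 1)
rAxis-adj q t = _ , d3 , sym (ℤP.+-identityʳ q) , refl

neighbours : Hex → List Hex
neighbours (q , r) =
  (q + + 1 , r + + 0) ∷ (q + -[1+ 0 ] , r + + 0) ∷ (q + + 0 , r + + 1) ∷
  (q + + 0 , r + -[1+ 0 ]) ∷ (q + + 1 , r + -[1+ 0 ]) ∷ (q + -[1+ 0 ] , r + + 1) ∷ []

Adjacent⇒∈neighbours : ∀ {a b} → Adjacent a b → b ∈ₗ neighbours a
Adjacent⇒∈neighbours (_ , d1 , refl , refl) = here refl
Adjacent⇒∈neighbours (_ , d2 , refl , refl) = there (here refl)
Adjacent⇒∈neighbours (_ , d3 , refl , refl) = there (there (here refl))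
Adjacent⇒∈neighbours (_ , d4 , refl , refl) = there (there (there (here refl)))
Adjacent⇒∈neighbours (_ , d5 , refl , refl) = there (there (there (there (here refl))))
Adjacent⇒∈neighbours (_ , d6 , refl , refl) = there (there (there (there (there (here refl)))))

∈neighbours⇒Adjacent : ∀ {a b} → b ∈ₗ neighbours a → Adjacent a b
∈neighbours⇒Adjacent (here refl) = _ , d1 , refl , refl
∈neighbours⇒Adjacent (there (here refl)) = _ , d2 , refl , refl
∈neighbours⇒Adjacent (there (there (here refl))) = _ , d3 , refl , refl
∈neighbours⇒Adjacent (there (there (there (here refl)))) = _ , d4 , refl , refl
∈neighbours⇒Adjacent (there (there (there (there (here refl))))) = _ , d5 , refl , refl
∈neighbours⇒Adjacent (there (there (there (there (there (here refl)))))) = _ , d6 , refl , refl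

_≟ₕ_ : DecidableEquality Hex
_≟ₕ_ = ≡-dec ℤP._≟_ ℤP._≟_

Reaches : (Hex → Set) → (Hex → Set) → Hex → Set
Reaches P G x = ∃[ y ] G y × Walk P x y

_∖_ : (Hex → Set) → Hex → Hex → Set
(P ∖ a) h = P h × h ≢ a

walk-reaches : ∀ {P G : Hex → Set} {x y} → G y → Walk P x y → Walk (Reaches P G) x y
walk-reaches gy (stop p) = stop (_ , gy , stop p)
walk-reaches gy (step p adj w) = step (_ , gy , step p adj w) adj (walk-reaches gy w)

-- Cut a walk at its last visit to a.
walk-leaving : ∀ {P : Hex → Set} a {x y} → Walk P x y →
  Walk (P ∖ a) x y ⊎ y ≡ a ⊎ ∃[ c ] Adjacent a c × Walk (P ∖ a) c y
walk-leaving a {x} (stop p) with x ≟ₕ a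
... | yes x≡a = inj₂ (inj₁ x≡a)
... | no x≢a = inj₁ (stop (p , x≢a))
walk-leaving a {x} (step p adj w) with walk-leaving a w
... | inj₂ later = inj₂ later
... | inj₁ w′ with x ≟ₕ a
...   | yes refl = inj₂ (inj₂ (_ , adj , w′))
...   | no x≢a = inj₁ (step (p , x≢a) adj w′)

-- Search by recursion on the size of the region: from x, either x is a target or one of its
-- neighbours reaches a target in the region with x deleted.
reaches? : ∀ {P G : Hex → Set} → Decidable P → Decidable G →
  (hs : List Hex) → (∀ {h} → P h → h ∈ₗ hs) → Decidable (Reaches P G)
reaches? {G = G} P? G? hs P⊆hs = search P? hs P⊆hs (<-wellFounded (length hs))
  where
  search : ∀ {P} → Decidable P → (hs : List Hex) → (∀ {h} → P h → h ∈ₗ hs) →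
    Acc _<_ (length hs) → Decidable (Reaches P G)
  search {P} P? hs P⊆hs (acc smaller) x with P? x | G? x
  ... | no ¬px | _ = no λ (_ , _ , w) → ¬px (walkHead w)
  ... | yes px | yes gx = yes (x , gx , stop px)
  ... | yes px | no ¬gx = map′ extend restrict (Any.any? reaches-without-x (neighbours x))
    where
    hs′ : List Hex
    hs′ = filter (λ h → ¬? (h ≟ₕ x)) hs

    shorter : length hs′ < length hs
    shorter = filter-notAll (λ h → ¬? (h ≟ₕ x)) hs (Any.map (λ x≡h h≢x → h≢x (sym x≡h)) (P⊆hs px))

    reaches-without-x : Decidable (Reaches (P ∖ x) G)
    reaches-without-x = search (λ h → P? h ×-dec ¬? (h ≟ₕ x)) hs′
      (λ (ph , h≢x) → ∈-filter⁺ (λ h → ¬? (h ≟ₕ x)) (P⊆hs ph) h≢x) (smaller shorter)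

    extend : Any (Reaches (P ∖ x) G) (neighbours x) → Reaches P G x
    extend any with find any
    ... | c , c∈ , (y , gy , w) = y , gy , step px (∈neighbours⇒Adjacent {x} c∈) (mapWalk proj₁ w)

    restrict : Reaches P G x → Any (Reaches (P ∖ x) G) (neighbours x)
    restrict (y , gy , w) with walk-leaving x w
    ... | inj₁ w′ = ⊥-elim (proj₂ (walkHead w′) refl)
    ... | inj₂ (inj₁ refl) = ⊥-elim (¬gx gy)
    ... | inj₂ (inj₂ (c , adj , w′)) = lose (Adjacent⇒∈neighbours {x} adj) (y , gy , w′)

record InBox (N : ℕ) (h : Hex) : Set where
  constructor inBox
  field
    q-bound : ∣ proj₁ h ∣ ≤ N
    r-bound : ∣ proj₂ h ∣ ≤ N

data Outside (N : ℕ) (h : Hex) : Set where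
  beyond-q : N < ∣ proj₁ h ∣ → Outside N h
  beyond-r : N < ∣ proj₂ h ∣ → Outside N h

outside? : ∀ N → Decidable (Outside N)
outside? N (q , r) = map′ [ beyond-q , beyond-r ] as-sum ((N ℕ.<? ∣ q ∣) ⊎-dec (N ℕ.<? ∣ r ∣))
  where
  as-sum : Outside N (q , r) → N < ∣ q ∣ ⊎ N < ∣ r ∣
  as-sum (beyond-q N<q) = inj₁ N<q
  as-sum (beyond-r N<r) = inj₂ N<r

InBox⇒¬Outside : ∀ {N h} → InBox N h → ¬ Outside N h
InBox⇒¬Outside (inBox q≤N _) (beyond-q N<q) = ℕP.<⇒≱ N<q q≤N
InBox⇒¬Outside (inBox _ r≤N) (beyond-r N<r) = ℕP.<⇒≱ N<r r≤N

¬Outside⇒InBox : ∀ {N h} → ¬ Outside N h → InBox N h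
¬Outside⇒InBox ¬out = inBox (ℕP.≮⇒≥ (¬out ∘ beyond-q)) (ℕP.≮⇒≥ (¬out ∘ beyond-r))

InBox-suc : ∀ {N h} → InBox N h → InBox (suc N) h
InBox-suc (inBox q≤N r≤N) = inBox (ℕP.m≤n⇒m≤1+n q≤N) (ℕP.m≤n⇒m≤1+n r≤N)

Dir⇒InBox1 : ∀ {d} → Dir d → InBox 1 d
Dir⇒InBox1 d1 = inBox (s≤s ℕ.z≤n) ℕ.z≤n
Dir⇒InBox1 d2 = inBox (s≤s ℕ.z≤n) ℕ.z≤n
Dir⇒InBox1 d3 = inBox ℕ.z≤n (s≤s ℕ.z≤n)
Dir⇒InBox1 d4 = inBox ℕ.z≤n (s≤s ℕ.z≤n)
Dir⇒InBox1 d5 = inBox (s≤s ℕ.z≤n) (s≤s ℕ.z≤n)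
Dir⇒InBox1 d6 = inBox (s≤s ℕ.z≤n) (s≤s ℕ.z≤n)

∣+∣≤suc : ∀ {N} a d → ∣ a ∣ ≤ N → ∣ d ∣ ≤ 1 → ∣ a + d ∣ ≤ suc N
∣+∣≤suc {N} a d a≤N d≤1 = ℕP.≤-trans (ℤP.∣i+j∣≤∣i∣+∣j∣ a d)
  (ℕP.≤-trans (ℕP.+-mono-≤ a≤N d≤1) (ℕP.≤-reflexive (ℕP.+-comm N 1)))

Adjacent-InBox : ∀ {N a b} → InBox N a → Adjacent a b → InBox (suc N) b
Adjacent-InBox {a = q , r} (inBox q≤N r≤N) (_ , dir , refl , refl) =
  inBox (∣+∣≤suc q _ q≤N (InBox.q-bound (Dir⇒InBox1 dir)))
        (∣+∣≤suc r _ r≤N (InBox.r-bound (Dir⇒InBox1 dir)))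

interval : ℕ → List ℤ
interval N = map +_ (upTo (suc N)) ++ map -[1+_] (upTo N)

∈-interval : ∀ {N} t → ∣ t ∣ ≤ N → t ∈ₗ interval N
∈-interval (+ n) n≤N = ∈-++⁺ˡ (∈-map⁺ +_ (∈-upTo⁺ (s≤s n≤N)))
∈-interval -[1+ n ] n<N = ∈-++⁺ʳ _ (∈-map⁺ -[1+_] (∈-upTo⁺ n<N))

box : ℕ → List Hex
box N = cartesianProduct (interval N) (interval N)

∈-box : ∀ {N} h → InBox N h → h ∈ₗ box N
∈-box (q , r) (inBox q≤N r≤N) = ∈-cartesianProduct⁺ (∈-interval q q≤N) (∈-interval r r≤N)

bound : List Hex → ℕ
bound [] = 0
bound ((q , r) ∷ hs) = ∣ q ∣ ℕ.⊔ ∣ r ∣ ℕ.⊔ bound hs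

∈⇒InBox-bound : ∀ {h} hs → h ∈ₗ hs → InBox (bound hs) h
∈⇒InBox-bound ((q , r) ∷ hs) (here refl) = inBox
  (ℕP.≤-trans (ℕP.m≤m⊔n ∣ q ∣ ∣ r ∣) (ℕP.m≤m⊔n _ (bound hs)))
  (ℕP.≤-trans (ℕP.m≤n⊔m ∣ q ∣ ∣ r ∣) (ℕP.m≤m⊔n _ (bound hs)))
∈⇒InBox-bound ((q , r) ∷ hs) (there h∈hs) with ∈⇒InBox-bound hs h∈hs
... | inBox q≤ r≤ = inBox (ℕP.≤-trans q≤ (ℕP.m≤n⊔m _ _)) (ℕP.≤-trans r≤ (ℕP.m≤n⊔m _ _))

Finite⇒bounded : ∀ {S} → Finite S → ∃[ N ] (∀ {h} → h ∈ S → InBox N h)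
Finite⇒bounded (hs , S⊆hs) = bound hs , λ {h} h∈S → ∈⇒InBox-bound hs (S⊆hs h h∈S)

Finite⇒misses-outside : ∀ {S} → Finite S → ∀ N → ∃[ z ] Outside N z × z ∈ compl S
Finite⇒misses-outside S-finite N with Finite⇒bounded S-finite
... | B , S⊆box = (+ suc (N ℕ.+ B) , + 0) , beyond-q (s≤s (ℕP.m≤m+n N B)) ,
  ∉⇒∈compl λ z∈S → ℕP.<⇒≱ (s≤s (ℕP.m≤n+m B N)) (InBox.q-bound (S⊆box z∈S))

LeastBenzenoidAbove : HexSet → HexSet → Set
LeastBenzenoidAbove K B = Benzenoid B × K ⊆ B × (∀ (L : HexSet) → Benzenoid L → K ⊆ L → B ⊆ L)

least⇒closure : ∀ {K B} → LeastBenzenoidAbove K B → ∀ h → (h ∈ B) ⇔ closure K h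
least⇒closure (B-benzenoid , K⊆B , B-least) h =
  mk⇔ (λ h∈B L L-benzenoid K⊆L → B-least L L-benzenoid K⊆L h h∈B) (λ h∈K̄ → h∈K̄ _ B-benzenoid K⊆B)

least-resp : ∀ {K B B′} → B ⊆ B′ → B′ ⊆ B → LeastBenzenoidAbove K B → LeastBenzenoidAbove K B′
least-resp B⊆B′ B′⊆B (B-benzenoid , K⊆B , B-least) =
  Benzenoid-resp B⊆B′ B′⊆B B-benzenoid , (λ h → B⊆B′ h ∘ K⊆B h) ,
  λ L L-benzenoid K⊆L h → B-least L L-benzenoid K⊆L h ∘ B′⊆B h

module Hull {K : HexSet} (K-coronoid : Coronoid K) where

  M : ℕ
  M = proj₁ (Finite⇒bounded (proj₁ K-coronoid))

  K⊆box : ∀ {h} → h ∈ K → InBox M h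
  K⊆box = proj₂ (Finite⇒bounded (proj₁ K-coronoid))

  outside⇒∉K : ∀ {h} → Outside M h → h ∈ compl K
  outside⇒∉K out = ∉⇒∈compl λ h∈K → InBox⇒¬Outside (K⊆box h∈K) out

  -- The search region is kept finite so that escaping is decidable.
  Free : Hex → Set
  Free h = InBox (suc M) h × h ∈ compl K

  Escapes : Hex → Set
  Escapes h = Outside M h ⊎ Reaches Free (Outside M) h

  escapes? : Decidable Escapes
  escapes? h = outside? M h ⊎-dec reaches? free? (outside? M) (box (suc M)) (∈-box _ ∘ proj₁) h
    where
    free? : Decidable Free
    free? h with ¬? (outside? (suc M) h) | K h ≟ᵇ false
    ... | yes inside | yes h∉K = yes (¬Outside⇒InBox inside , cong not h∉K)
    ... | no ¬inside | _ = no λ (in-box , _) → ¬inside (InBox⇒¬Outside in-box)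
    ... | _ | no h∈K = no λ (_ , h∉K) → h∈K (not-injective h∉K)

  escapes-backwards : ∀ {a b} → a ∈ compl K → Adjacent a b → Escapes b → Escapes a
  escapes-backwards {a} a∉K adj b-escapes with outside? M a
  ... | yes a-out = inj₁ a-out
  ... | no a-in = inj₂ (extend b-escapes)
    where
    a-free : Free a
    a-free = InBox-suc (¬Outside⇒InBox a-in) , a∉K

    extend : Escapes _ → Reaches Free (Outside M) a
    extend (inj₁ b-out) =
      _ , b-out , step a-free adj (stop (Adjacent-InBox (¬Outside⇒InBox a-in) adj , outside⇒∉K b-out))
    extend (inj₂ (y , y-out , w)) = y , y-out , step a-free adj w

  escapes-along : ∀ {x y} → Walk (_∈ compl K) x y → Escapes y → Escapes x
  escapes-along (stop _) y-escapes = y-escapes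
  escapes-along (step x∉K adj w) y-escapes = escapes-backwards x∉K adj (escapes-along w y-escapes)

  hull : HexSet
  hull h = not (does (escapes? h))

  Escapes⇒∉hull : ∀ {h} → Escapes h → h ∈ compl hull
  Escapes⇒∉hull {h} esc = cong (not ∘ not) (dec-true (escapes? h) esc)

  ¬Escapes⇒∈hull : ∀ {h} → ¬ Escapes h → h ∈ hull
  ¬Escapes⇒∈hull {h} ¬esc = cong not (dec-false (escapes? h) ¬esc)

  ∈hull⇒¬Escapes : ∀ {h} → h ∈ hull → ¬ Escapes h
  ∈hull⇒¬Escapes h∈ esc = ∈compl⇒∉ (Escapes⇒∉hull esc) h∈

  ∉hull⇒Escapes : ∀ {h} → h ∈ compl hull → Escapes h
  ∉hull⇒Escapes {h} h∉ = decidable-stable (escapes? h) (∈compl⇒∉ h∉ ∘ ¬Escapes⇒∈hull)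

  K⊆hull : K ⊆ hull
  K⊆hull h h∈K = ¬Escapes⇒∈hull λ where
    (inj₁ out) → InBox⇒¬Outside (K⊆box h∈K) out
    (inj₂ (_ , _ , w)) → ∈compl⇒∉ (proj₂ (walkHead w)) h∈K

  hull⊆box : ∀ {h} → h ∈ hull → InBox M h
  hull⊆box h∈ = ¬Outside⇒InBox (∈hull⇒¬Escapes h∈ ∘ inj₁)

  hull-finite : Finite hull
  hull-finite = box M , λ h → ∈-box h ∘ hull⊆box

  walk-to-K : ∀ {x y} → Walk (λ _ → ⊤) x y → x ∈ hull → Escapes y → ∃[ k ] k ∈ K × Walk (_∈ hull) x k
  walk-to-K (stop _) x∈ y-escapes = ⊥-elim (∈hull⇒¬Escapes x∈ y-escapes)
  walk-to-K {x} (step _ adj w) x∈ y-escapes with K x ≟ᵇ true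
  ... | yes x∈K = x , x∈K , stop x∈
  ... | no x∉K =
    let next∈ = ¬Escapes⇒∈hull (∈hull⇒¬Escapes x∈ ∘ escapes-backwards (∉⇒∈compl x∉K) adj)
        (k , k∈K , w′) = walk-to-K w next∈ y-escapes
    in k , k∈K , step x∈ adj w′

  hull-reaches-K : ∀ {h} → h ∈ hull → ∃[ k ] k ∈ K × Walk (_∈ hull) h k
  hull-reaches-K {q , r} h∈ =
    walk-to-K (walk-along (λ t → t , r) (qAxis-adj r) (λ _ → tt) q (+ suc M)) h∈ (inj₁ (beyond-q ℕP.≤-refl))

  hull-connected : Connected hull
  hull-connected with proj₂ K-coronoid
  ... | (k₀ , k₀∈K) , K-walks = (k₀ , K⊆hull k₀ k₀∈K) , walks
    where

    walks : ∀ a b → a ∈ hull → b ∈ hull → Walk (_∈ hull) a b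
    walks a b a∈ b∈ with hull-reaches-K a∈ | hull-reaches-K b∈
    ... | ka , ka∈K , wa | kb , kb∈K , wb =
      wa ◅◅ mapWalk (K⊆hull _) (K-walks ka kb ka∈K kb∈K) ◅◅ reverse wb

  corner : Hex
  corner = + suc M , + suc M

  outside-route : ∀ {y} → Outside M y → Walk (Outside M) y corner
  outside-route {q , r} (beyond-q M<q) =
    walk-along (λ t → q , t) (rAxis-adj q) (λ _ → beyond-q M<q) r (+ suc M) ◅◅
    walk-along (λ t → t , + suc M) (qAxis-adj (+ suc M)) (λ _ → beyond-r ℕP.≤-refl) q (+ suc M)
  outside-route {q , r} (beyond-r M<r) =
    walk-along (λ t → t , r) (qAxis-adj r) (λ _ → beyond-r M<r) q (+ suc M) ◅◅
    walk-along (λ t → + suc M , t) (rAxis-adj (+ suc M)) (λ _ → beyond-q ℕP.≤-refl) r (+ suc M)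

  escape-route : ∀ {h} → Escapes h → Walk Escapes h corner
  escape-route (inj₁ out) = mapWalk inj₁ (outside-route out)
  escape-route (inj₂ (y , y-out , w)) =
    mapWalk inj₂ (walk-reaches y-out w) ◅◅ mapWalk inj₁ (outside-route y-out)

  hull-compl-connected : Connected (compl hull)
  hull-compl-connected = (corner , Escapes⇒∉hull {corner} (inj₁ (beyond-q ℕP.≤-refl))) , λ a b a∉ b∉ →
    mapWalk Escapes⇒∉hull
      (escape-route (∉hull⇒Escapes {a} a∉) ◅◅ reverse (escape-route (∉hull⇒Escapes {b} b∉)))

  hull-minimal : ∀ L → Benzenoid L → K ⊆ L → hull ⊆ L
  hull-minimal L ((L-finite , _) , L-compl-connected) K⊆L h h∈ = ∉compl⇒∈ λ h∉L →
    let (z , z-out , z∉L) = Finite⇒misses-outside L-finite M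
    in ∈hull⇒¬Escapes h∈
         (escapes-along (mapWalk (compl-anti K⊆L _) (proj₂ L-compl-connected h z h∉L z∉L)) (inj₁ z-out))

  hull-isLeastBenzenoid : LeastBenzenoidAbove K hull
  hull-isLeastBenzenoid = ((hull-finite , hull-connected) , hull-compl-connected) , K⊆hull , hull-minimal

lemma2p14 : (K : HexSet) → Coronoid K → (K~ : HexSet) →
    (Benzenoid K~ × K ⊆ K~ × (∀ (L : HexSet) → Benzenoid L → K ⊆ L → K~ ⊆ L))
    ⇔ (∀ h → (h ∈ K~) ⇔ closure K h)
lemma2p14 K K-coronoid K~ = mk⇔ least⇒closure K~-least
  where
  open Hull K-coronoid using (hull; hull-isLeastBenzenoid)
  open Equivalence

  K~-least : (∀ h → (h ∈ K~) ⇔ closure K h) → LeastBenzenoidAbove K K~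
  K~-least K~≐closure = least-resp hull⊆K~ K~⊆hull hull-isLeastBenzenoid
    where
    hull≐closure : ∀ h → (h ∈ hull) ⇔ closure K h
    hull≐closure = least⇒closure hull-isLeastBenzenoid

    hull⊆K~ : hull ⊆ K~
    hull⊆K~ h = from (K~≐closure h) ∘ to (hull≐closure h)

    K~⊆hull : K~ ⊆ hull
    K~⊆hull h = from (hull≐closure h) ∘ to (K~≐closure h)
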